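{- For all $n\ge 2$, $a(n+1)\ge a(n)+1$.
   Context: Let $P_n$ denote the $n$-th prime ($P_1=2$). For $n>1$, $a(n)$ is the integer such that $\prod_{r=n}^{n+a(n)-2}\frac{P_r}{P_r-1}<2<\prod_{r=n}^{n+a(n)-1}\frac{P_r}{P_r-1}$. -}

module Defs where

open import Data.Nat using (ℕ; zero; suc; _+_; _∸_; _!)

open import Data.Nat.Primality using (prime?)
open import Data.Integer using (+_)
open import Data.Rational using (ℚ; _/_; _*_; 1ℚ)
open import Relation.Nullary using (yes; no)

-- First prime in {m, m+1, ..., m+fuel-1} (fallback 0 if none; never
-- reached when used below).
findPrime : ℕ → ℕ → ℕ
findPrime zero     m = 0
findPrime (suc f) m with prime? m
... | yes _ = m
... | no  _ = findPrime f (suc m)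

-- Smallest prime strictly greater than p.  By Euclid's argument there is
-- a prime in (p, p! + 1], so searching p! + 1 candidates from p+1 suffices.
nextPrime : ℕ → ℕ
nextPrime p = findPrime (p ! + 1) (suc p)

-- P n = n-th prime, 1-indexed: P 1 = 2, P 2 = 3, ...  (P 0 = 2 is junk.)
P : ℕ → ℕ
P zero          = 2
P (suc zero)    = 2
P (suc (suc n)) = nextPrime (P (suc n))

-- The factor p/(p-1) as a rational.  For every prime p ≥ 2 we have
-- suc (p ∸ 2) = p - 1, which lets Agda see the denominator is nonzero.
factor : ℕ → ℚ
factor p = + p / suc (p ∸ 2)

prodFrom : ℕ → ℕ → ℚ
prodFrom n zero    = 1ℚ
prodFrom n (suc m) = prodFrom n m * factor (P (n + m))

-- IsA n k  :⇔  ∏_{r=n}^{n+k-2} P_r/(P_r-1) < 2 < ∏_{r=n}^{n+k-1} P_r/(P_r-1),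
-- i.e. k is the value a(n) from the paper.
open import Data.Rational using (_<_)
open import Data.Product using (_×_)

2ℚ : ℚ
2ℚ = + 2 / 1

IsA : ℕ → ℕ → Set
IsA n k = (prodFrom n (k ∸ 1) < 2ℚ) × (2ℚ < prodFrom n k)

module Submission where

-- Fix n ≥ 2 and write q i = P (n + i), so q 0 = p is an odd
-- prime and consecutive terms differ by at least 2.  The window product
-- prodFrom n m equals Num q m / Den q m, where Num q m = ∏_{i<m} q i and
-- Den q m = ∏_{i<m} (q i - 1); hence a(n) = j + 1 means
--   Num q j < 2 · Den q j   and   2 · Den q (j+1) < Num q (j+1).
-- For a = q j, b = q (j+1):
--  * since (b/(b-1))² ≤ b/a whenever b ≥ a + 2, the squared window product
--    telescopes to at most a/(p-2); as it exceeds 4, a > 4(p-2);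
--  * for such a and b, (a/(a-1))·(b/(b-1)) ≤ p/(p-1).
-- So shifting the window by one (dropping p, adding a and b to q 0..q (j-1))
-- keeps the product of q 1..q (j+1) at most 2.  Window products grow with
-- their length, so the first window starting at n+1 that exceeds 2 is longer
-- than j + 1, i.e. a(n+1) ≥ a(n) + 1.
-- The file first proves the needed facts about primes (P r is prime and,
-- for r ≥ 2, P (r+1) ≥ P r + 2), then general facts about ratios of finite
-- products (the threshold lemma), then the translation of prodFrom into
-- integers, then three polynomial inequalities, and finally the two
-- inequalities above for any sequence starting at ≥ 3 with gaps ≥ 2.

open import Defs
open import Data.Nat using (ℕ; _≤_; _+_)
open import Data.Nat
  using (zero; suc; _*_; _∸_; _<_; _!; _<?_; NonZero; s≤s; z≤n; >-nonZero; nonTrivial⇒n>1; nonTrivial⇒≢1)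
open import Data.Nat.Properties
open import Data.Nat.Divisibility
  using (_∣_; divides; ∣-refl; ∣-trans; m∣m*n; ∣⇒≤; ∣1⇒≡1; ∣m∣n⇒∣m+n; ∣m+n∣m⇒∣n; m≤n⇒m!∣n!)
open import Data.Nat.Primality using (Prime; prime?; prime[2]; prime⇒nonTrivial; prime⇒irreducible)
open import Data.Nat.Primality.Factorisation using (factorise)
open import Data.Nat.ListAction using (product)
open import Data.Nat.Tactic.RingSolver using (solve-∀)
open import Algebra.Properties.CommutativeSemigroup *-commutativeSemigroup
  using () renaming (xy∙z≈xz∙y to *-right-comm)
open import Data.List using ([]; _∷_)
open import Data.List.Relation.Unary.All using (_∷_)
open import Data.Integer using (+_)
open import Data.Integer.Properties using (pos-*; drop‿+<+)
import Data.Integer as ℤ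
import Data.Rational as ℚ
open import Data.Rational.Properties using (toℚᵘ-homo-*; toℚᵘ-fromℚᵘ; toℚᵘ-mono-<)
open import Data.Rational.Unnormalised using (ℚᵘ; mkℚᵘ; _≃_; *<*)
import Data.Rational.Unnormalised as U
open import Data.Rational.Unnormalised.Properties using (≃-refl; *-cong; <-respˡ-≃; <-respʳ-≃; module ≃-Reasoning)
open import Data.Product using (∃-syntax; _×_; _,_; proj₁; proj₂)
open import Data.Sum using (_⊎_; inj₁; inj₂)
open import Data.Empty using (⊥-elim)
open import Function using (_∘_)
open import Relation.Nullary using (¬_; yes; no; contradiction)
open import Relation.Binary.PropositionalEquality
  using (_≡_; refl; sym; cong; cong₂; subst; subst₂; module ≡-Reasoning)


findPrime-spec : ∀ f m {q} → Prime q → m ≤ q → q < m + f →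
                 Prime (findPrime f m) × m ≤ findPrime f m
findPrime-spec zero    m {q} pq m≤q q<m+0 = contradiction (subst (q <_) (+-identityʳ m) q<m+0) (≤⇒≯ m≤q)
findPrime-spec (suc f) m {q} pq m≤q q<m+1+f with prime? m
... | yes pm = pm , ≤-refl
... | no ¬pm with m≤n⇒m<n∨m≡n m≤q
...   | inj₂ refl = contradiction pq ¬pm
...   | inj₁ m<q =
  let pr , 1+m≤r = findPrime-spec f (suc m) pq m<q (subst (q <_) (+-suc m f) q<m+1+f)
  in  pr , ≤-trans (n≤1+n m) 1+m≤r

∣-factorial : ∀ {q m} → 1 ≤ q → q ≤ m → q ∣ m !
∣-factorial {suc q} _ q≤m = ∣-trans (m∣m*n (q !)) (m≤n⇒m!∣n! q≤m)

m!+1≢0 : ∀ m → NonZero (m ! + 1)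
m!+1≢0 m = >-nonZero (m≤n+m 1 (m !))

-- Euclid: any prime factor of m! + 1 is a prime in (m, m! + 1].
euclid : ∀ m → ∃[ q ] Prime q × m < q × q ≤ m ! + 1
euclid m with factorise (m ! + 1) {{m!+1≢0 m}}
... | record { factors = [] ; isFactorisation = N≡1 } =
  contradiction (m<n+m 1 (1≤n! m)) (<-irrefl (sym N≡1))
... | record { factors = q ∷ qs ; isFactorisation = N≡q*qs ; factorsPrime = pq ∷ _ } =
  q , pq , ≰⇒> q≰m , ∣⇒≤ {{m!+1≢0 m}} q∣N
  where
  instance _ = prime⇒nonTrivial pq
  q∣N : q ∣ m ! + 1
  q∣N = subst (q ∣_) (sym N≡q*qs) (m∣m*n (product qs))
  q≰m : ¬ q ≤ m
  q≰m q≤m = nonTrivial⇒≢1 (∣1⇒≡1 (∣m+n∣m⇒∣n q∣N (∣-factorial (<⇒≤ (nonTrivial⇒n>1 q)) q≤m)))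

nextPrime-spec : ∀ p → Prime (nextPrime p) × p < nextPrime p
nextPrime-spec p with euclid p
... | q , pq , p<q , q≤N = findPrime-spec (p ! + 1) (suc p) pq p<q (s≤s (≤-trans q≤N (m≤n+m _ p)))

P-prime : ∀ r → Prime (P r)
P-prime zero          = prime[2]
P-prime (suc zero)    = prime[2]
P-prime (suc (suc r)) = proj₁ (nextPrime-spec (P (suc r)))

P≥2 : ∀ r → 2 ≤ P r
P≥2 r = nonTrivial⇒n>1 (P r) {{prime⇒nonTrivial (P-prime r)}}

P≥3 : ∀ r → 2 ≤ r → 3 ≤ P r
P≥3 (suc zero)    (s≤s ())
P≥3 (suc (suc r)) _ = ≤-trans (s≤s (P≥2 (suc r))) (proj₂ (nextPrime-spec (P (suc r))))

even-or-odd : ∀ n → 2 ∣ n ⊎ 2 ∣ suc n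
even-or-odd zero = inj₁ (divides 0 refl)
even-or-odd (suc n) with even-or-odd n
... | inj₁ 2∣n   = inj₂ (∣m∣n⇒∣m+n ∣-refl 2∣n)
... | inj₂ 2∣1+n = inj₁ 2∣1+n

even-prime : ∀ {p} → Prime p → 2 ∣ p → p ≡ 2
even-prime pp 2∣p with prime⇒irreducible pp 2∣p
... | inj₁ ()
... | inj₂ 2≡p = sym 2≡p

-- Two odd primes are never adjacent, so larger odd primes are ≥ 2 larger.
odd-prime-gap : ∀ {a b} → Prime a → Prime b → 3 ≤ a → a < b → 2 + a ≤ b
odd-prime-gap {a} pa pb 3≤a a<b with m≤n⇒m<n∨m≡n a<b
... | inj₁ 1+a<b = 1+a<b
... | inj₂ refl with even-or-odd a
...   | inj₁ 2∣a   = contradiction 3≤a (<-irrefl (sym (even-prime pa 2∣a)))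
...   | inj₂ 2∣1+a = contradiction (≤-trans 3≤a (n≤1+n a)) (<-irrefl (sym (even-prime pb 2∣1+a)))

P-gap : ∀ r → 2 ≤ r → 2 + P r ≤ P (suc r)
P-gap (suc r) 2≤r =
  odd-prime-gap (P-prime (suc r)) (P-prime (suc (suc r))) (P≥3 (suc r) 2≤r) (proj₂ (nextPrime-spec (P (suc r))))

primesFrom : ℕ → ℕ → ℕ
primesFrom n i = P (n + i)

primesFrom-start : ∀ n → 2 ≤ n → 3 ≤ primesFrom n 0
primesFrom-start n 2≤n = P≥3 (n + 0) (≤-trans 2≤n (m≤m+n n 0))

primesFrom-gap : ∀ n → 2 ≤ n → ∀ i → 2 + primesFrom n i ≤ primesFrom n (suc i)
primesFrom-gap n 2≤n i =
  subst (λ r → 2 + P (n + i) ≤ P r) (sym (+-suc n i)) (P-gap (n + i) (≤-trans 2≤n (m≤m+n n i)))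


prod : (ℕ → ℕ) → ℕ → ℕ
prod f zero    = 1
prod f (suc m) = prod f m * f m

prod-cong : ∀ {f g} → (∀ i → f i ≡ g i) → ∀ m → prod f m ≡ prod g m
prod-cong f≗g zero    = refl
prod-cong f≗g (suc m) = cong₂ _*_ (prod-cong f≗g m) (f≗g m)

prod-shift : ∀ f m → prod f (suc m) ≡ f 0 * prod (f ∘ suc) m
prod-shift f zero    = *-comm 1 (f 0)
prod-shift f (suc m) = begin
  prod f (suc m) * f (suc m)          ≡⟨ cong (_* f (suc m)) (prod-shift f m) ⟩
  f 0 * prod (f ∘ suc) m * f (suc m)  ≡⟨ *-assoc (f 0) _ _ ⟩
  f 0 * prod (f ∘ suc) (suc m)        ∎
  where open ≡-Reasoning

prod-pos : ∀ f → (∀ i → 1 ≤ f i) → ∀ m → 1 ≤ prod f m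
prod-pos f f≥1 zero    = ≤-refl
prod-pos f f≥1 (suc m) = *-mono-≤ (prod-pos f f≥1 m) (f≥1 m)

-- If g ≤ f pointwise, the ratio prod f / prod g does not decrease with the length.
ratio-mono : ∀ {f g} → (∀ i → g i ≤ f i) → ∀ m e →
             prod f m * prod g (m + e) ≤ prod f (m + e) * prod g m
ratio-mono {f} {g} g≤f m zero rewrite +-identityʳ m = ≤-refl
ratio-mono {f} {g} g≤f m (suc e) rewrite +-suc m e = begin
  F * (G′ * g (m + e))  ≡⟨ *-assoc F G′ _ ⟨
  F * G′ * g (m + e)    ≤⟨ *-mono-≤ (ratio-mono g≤f m e) (g≤f (m + e)) ⟩
  F′ * G * f (m + e)    ≡⟨ *-right-comm F′ G _ ⟩
  F′ * f (m + e) * G    ∎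
  where
  open ≤-Reasoning
  F G F′ G′ : ℕ
  F = prod f m ; G = prod g m ; F′ = prod f (m + e) ; G′ = prod g (m + e)

-- Hence once prod f exceeds c · prod g it stays above: a length m where
-- prod f m ≤ c · prod g m lies before any length k where it is exceeded.
threshold : ∀ {f g} c → (∀ i → g i ≤ f i) → (∀ i → 1 ≤ g i) → ∀ {m k} →
            prod f m ≤ c * prod g m → c * prod g k < prod f k → m < k
threshold {f} {g} c g≤f g≥1 {m} {k} below above with m <? k
... | yes m<k = m<k
... | no m≮k with m≤n⇒∃[o]m+o≡n (≮⇒≥ m≮k)
...   | e , refl = ⊥-elim (<-irrefl refl (begin-strict
  c * G * G′  <⟨ *-monoˡ-< G′ {{>-nonZero (prod-pos g g≥1 (k + e))}} above ⟩
  F * G′      ≤⟨ ratio-mono g≤f k e ⟩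
  F′ * G      ≤⟨ *-monoˡ-≤ G below ⟩
  c * G′ * G  ≡⟨ *-right-comm c G′ G ⟩
  c * G * G′  ∎))
  where
  open ≤-Reasoning
  F G F′ G′ : ℕ
  F = prod f k ; G = prod g k ; F′ = prod f (k + e) ; G′ = prod g (k + e)


-- The denominator of the factor p/(p-1) used in prodFrom (equal to p - 1 for p ≥ 1).
minus1 : ℕ → ℕ
minus1 p = suc (p ∸ 2)

minus1≤ : ∀ {p} → 1 ≤ p → minus1 p ≤ p
minus1≤ {suc zero}    _ = ≤-refl
minus1≤ {suc (suc p)} _ = n≤1+n (suc p)

Num Den : (ℕ → ℕ) → ℕ → ℕ
Num q = prod q
Den q = prod (minus1 ∘ q)

Den-pos : ∀ q m → 1 ≤ Den q m
Den-pos q = prod-pos (minus1 ∘ q) (λ _ → s≤s z≤n)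

-- The unnormalised rational a/b, for b ≥ 1.
frac : ℕ → ℕ → ℚᵘ
frac a b = mkℚᵘ (+ a) (b ∸ 1)

frac-* : ∀ a c {b d} → 1 ≤ b → 1 ≤ d → frac a b U.* frac c d ≡ frac (a * c) (b * d)
frac-* a c (s≤s z≤n) (s≤s z≤n) = cong (λ z → mkℚᵘ z _) (sym (pos-* a c))

frac-< : ∀ a c {b d} → 1 ≤ b → 1 ≤ d → frac a b U.< frac c d → a * d < c * b
frac-< a c (s≤s z≤n) (s≤s z≤n) (*<* lt) =
  drop‿+<+ (subst₂ ℤ._<_ (sym (pos-* a _)) (sym (pos-* c _)) lt)

prodFrom≃frac : ∀ n m → ℚ.toℚᵘ (prodFrom n m) ≃ frac (Num (primesFrom n) m) (Den (primesFrom n) m)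
prodFrom≃frac n zero    = ≃-refl
prodFrom≃frac n (suc m) = begin
  ℚ.toℚᵘ (prodFrom n m ℚ.* factor p)           ≈⟨ toℚᵘ-homo-* (prodFrom n m) (factor p) ⟩
  ℚ.toℚᵘ (prodFrom n m) U.* ℚ.toℚᵘ (factor p)  ≈⟨ *-cong (prodFrom≃frac n m) (toℚᵘ-fromℚᵘ (frac p (minus1 p))) ⟩
  frac N D U.* frac p (minus1 p)               ≡⟨ frac-* N p (Den-pos (primesFrom n) m) (s≤s z≤n) ⟩
  frac (N * p) (D * minus1 p)                  ∎
  where
  open ≃-Reasoning
  p N D : ℕ
  p = P (n + m) ; N = Num (primesFrom n) m ; D = Den (primesFrom n) m

below-two : ∀ n m → prodFrom n m ℚ.< 2ℚ → Num (primesFrom n) m < 2 * Den (primesFrom n) m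
below-two n m lt = subst (_< 2 * Den (primesFrom n) m) (*-identityʳ _)
  (frac-< _ 2 (Den-pos (primesFrom n) m) (s≤s z≤n) (<-respˡ-≃ (prodFrom≃frac n m) (toℚᵘ-mono-< lt)))

above-two : ∀ n m → 2ℚ ℚ.< prodFrom n m → 2 * Den (primesFrom n) m < Num (primesFrom n) m
above-two n m lt = subst (2 * Den (primesFrom n) m <_) (*-identityʳ _)
  (frac-< 2 _ (s≤s z≤n) (Den-pos (primesFrom n) m) (<-respʳ-≃ (prodFrom≃frac n m) (toℚᵘ-mono-< lt)))


-- x ≤ y whenever y = x + e; combined with a ring identity this proves
-- a polynomial inequality.
≤-by : ∀ x e y → x + e ≡ y → x ≤ y
≤-by x e y x+e≡y = subst (x ≤_) x+e≡y (m≤m+n x e)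

first-square : ∀ {p} → 3 ≤ p → p * p * (p ∸ 2) ≤ minus1 p * minus1 p * p
first-square {suc zero}          (s≤s ())
first-square {suc (suc zero)}    (s≤s (s≤s ()))
first-square {suc (suc (suc t))} _ = ≤-by _ _ _ (identity t)
  where
  identity : ∀ t → (3 + t) * (3 + t) * (1 + t) + (3 + t) ≡ (2 + t) * (2 + t) * (3 + t)
  identity = solve-∀

next-square : ∀ {a b} → 2 + a ≤ b → a * b ≤ minus1 b * minus1 b
next-square {a} 2+a≤b with m≤n⇒∃[o]m+o≡n 2+a≤b
... | w , refl = ≤-by _ _ _ (identity a w)
  where
  identity : ∀ a w → a * (2 + a + w) + (1 + w * w + a * w + 2 * w) ≡ (1 + a + w) * (1 + a + w)
  identity = solve-∀

pair-bound : ∀ {p a b} → 3 ≤ p → 4 * (p ∸ 2) < a → 2 + a ≤ b →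
             a * b * minus1 p ≤ minus1 a * minus1 b * p
pair-bound {suc zero}          (s≤s ())
pair-bound {suc (suc zero)}    (s≤s (s≤s ()))
pair-bound {suc (suc (suc t))} {a} _ large gap
  with m≤n⇒∃[o]m+o≡n (subst (_< a) (*-suc 4 t) large) | m≤n⇒∃[o]m+o≡n gap
... | u , refl | v , refl = ≤-by _ _ _ (identity t u v)
  where
  identity : ∀ t u v →
    (5 + 4 * t + u) * (7 + 4 * t + u + v) * (2 + t)
      + (2 + 13 * t + 8 * t * t + 6 * u + 2 * v + 6 * t * u + 3 * t * v + u * u + u * v)
    ≡ (4 + 4 * t + u) * (6 + 4 * t + u + v) * (3 + t)
  identity = solve-∀


-- Throughout, q is any sequence with q 0 ≥ 3 and gaps ≥ 2 (for n ≥ 2,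
-- primesFrom n is one) and p = q 0.
module GappedSequence (q : ℕ → ℕ) (3≤q₀ : 3 ≤ q 0) (gap : ∀ i → 2 + q i ≤ q (suc i)) where

  p : ℕ
  p = q 0

  -- Telescoping (b/(b-1))² ≤ b/a: the squared window product of q 0 .. q j is at most q j/(p-2).
  squares-bound : ∀ j → Num q (suc j) * Num q (suc j) * (p ∸ 2) ≤ Den q (suc j) * Den q (suc j) * q j
  squares-bound zero = begin
    (1 * p) * (1 * p) * (p ∸ 2)           ≡⟨ cong (λ x → x * x * (p ∸ 2)) (*-identityˡ p) ⟩
    p * p * (p ∸ 2)                       ≤⟨ first-square 3≤q₀ ⟩
    minus1 p * minus1 p * p               ≡⟨ cong (λ x → x * x * p) (*-identityˡ (minus1 p)) ⟨
    (1 * minus1 p) * (1 * minus1 p) * p   ∎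
    where open ≤-Reasoning
  squares-bound (suc j) = begin
    (N * b) * (N * b) * (p ∸ 2)          ≡⟨ regroup₁ N b (p ∸ 2) ⟩
    (N * N * (p ∸ 2)) * (b * b)          ≤⟨ *-monoˡ-≤ (b * b) (squares-bound j) ⟩
    (D * D * a) * (b * b)                ≡⟨ regroup₂ D a b ⟩
    (D * D) * (a * b) * b                ≤⟨ *-monoˡ-≤ b (*-monoʳ-≤ (D * D) (next-square (gap j))) ⟩
    (D * D) * (minus1 b * minus1 b) * b  ≡⟨ regroup₃ D (minus1 b) b ⟩
    (D * minus1 b) * (D * minus1 b) * b  ∎
    where
    open ≤-Reasoning
    N D a b : ℕ
    N = Num q (suc j) ; D = Den q (suc j) ; a = q j ; b = q (suc j)
    regroup₁ : ∀ x y z → (x * y) * (x * y) * z ≡ (x * x * z) * (y * y)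
    regroup₁ = solve-∀
    regroup₂ : ∀ x y z → (x * x * y) * (z * z) ≡ (x * x) * (y * z) * z
    regroup₂ = solve-∀
    regroup₃ : ∀ x y z → (x * x) * (y * y) * z ≡ (x * y) * (x * y) * z
    regroup₃ = solve-∀

  lower-bound : ∀ j → 2 * Den q (suc j) < Num q (suc j) → 4 * (p ∸ 2) < q j
  lower-bound j above = *-cancelʳ-< (D * D) (4 * (p ∸ 2)) (q j) (begin-strict
    4 * (p ∸ 2) * (D * D)        ≡⟨ regroup D (p ∸ 2) ⟩
    (2 * D) * (2 * D) * (p ∸ 2)  <⟨ *-monoˡ-< (p ∸ 2) {{p∸2≢0}} (*-mono-< above above) ⟩
    N * N * (p ∸ 2)              ≤⟨ squares-bound j ⟩
    D * D * q j                  ≡⟨ *-comm (D * D) (q j) ⟩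
    q j * (D * D)                ∎)
    where
    open ≤-Reasoning
    N D : ℕ
    N = Num q (suc j) ; D = Den q (suc j)
    p∸2≢0 : NonZero (p ∸ 2)
    p∸2≢0 = >-nonZero (∸-monoˡ-≤ 2 3≤q₀)
    regroup : ∀ x y → 4 * y * (x * x) ≡ (2 * x) * (2 * x) * y
    regroup = solve-∀

  -- Main step: if q 0 .. q (j-1) has product ≤ 2 but q 0 .. q j has product > 2,
  -- then q 1 .. q (j+1) has product ≤ 2, as it differs from the former by
  -- the factor (a/(a-1))·(b/(b-1)) / (p/(p-1)) ≤ 1, where a = q j, b = q (j+1).
  window-step : ∀ j → Num q j ≤ 2 * Den q j → 2 * Den q (suc j) < Num q (suc j) →
                Num (q ∘ suc) (suc j) ≤ 2 * Den (q ∘ suc) (suc j)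
  window-step j below above = *-cancelʳ-≤ N′ (2 * D′) (p * minus1 p) {{p*[p-1]≢0}} (begin
    N′ * (p * minus1 p)                              ≡⟨ regroup₁ N′ p (minus1 p) ⟩
    p * N′ * minus1 p                                ≡⟨ cong (_* minus1 p) (prod-shift q (suc j)) ⟨
    Num q j * a * b * minus1 p                       ≡⟨ regroup₂ (Num q j) a b (minus1 p) ⟩
    Num q j * (a * b * minus1 p)                     ≤⟨ *-mono-≤ below (pair-bound 3≤q₀ (lower-bound j above) (gap j)) ⟩
    2 * Den q j * (minus1 a * minus1 b * p)          ≡⟨ regroup₃ (Den q j) (minus1 a) (minus1 b) p ⟩
    Den q j * minus1 a * minus1 b * (2 * p)          ≡⟨ cong (_* (2 * p)) (prod-shift (minus1 ∘ q) (suc j)) ⟩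
    minus1 p * D′ * (2 * p)                          ≡⟨ regroup₄ (minus1 p) D′ p ⟩
    2 * D′ * (p * minus1 p)                          ∎)
    where
    open ≤-Reasoning
    N′ D′ a b : ℕ
    N′ = Num (q ∘ suc) (suc j) ; D′ = Den (q ∘ suc) (suc j) ; a = q j ; b = q (suc j)
    p*[p-1]≢0 : NonZero (p * minus1 p)
    p*[p-1]≢0 = m*n≢0 p (minus1 p) {{>-nonZero (≤-trans (s≤s z≤n) 3≤q₀)}}
    regroup₁ : ∀ x y z → x * (y * z) ≡ y * x * z
    regroup₁ = solve-∀
    regroup₂ : ∀ w x y z → w * x * y * z ≡ w * (x * y * z)
    regroup₂ = solve-∀
    regroup₃ : ∀ w x y z → 2 * w * (x * y * z) ≡ w * x * y * (2 * z)
    regroup₃ = solve-∀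
    regroup₄ : ∀ x y z → x * y * (2 * z) ≡ 2 * y * (z * x)
    regroup₄ = solve-∀


proposition2 : ∀ (n : ℕ) → 2 ≤ n → ∀ (k k′ : ℕ) →
    IsA n k → IsA (n + 1) k′ → k + 1 ≤ k′
-- a(n) ≥ 1, as the empty product is 1 < 2.
proposition2 n 2≤n zero    k′ (_ , above) _ = contradiction (above-two n 0 above) λ { (s≤s ()) }
proposition2 n 2≤n (suc j) k′ (below , above) (_ , above′) =
  subst (_≤ k′) (+-comm 1 (suc j))
    (threshold 2 (λ i → minus1≤ (<⇒≤ (P≥2 (n + suc i)))) (λ _ → s≤s z≤n) shifted-below shifted-above)
  where
  q : ℕ → ℕ
  q = primesFrom n
  open GappedSequence q (primesFrom-start n 2≤n) (primesFrom-gap n 2≤n)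

  -- a(n) = j + 1, so the window of length j + 1 starting at n + 1 has product ≤ 2 ...
  shifted-below : Num (q ∘ suc) (suc j) ≤ 2 * Den (q ∘ suc) (suc j)
  shifted-below = window-step j (<⇒≤ (below-two n j below)) (above-two n (suc j) above)

  -- ... while the one of length a(n+1) = k′ has product > 2.
  drop-first : ∀ i → primesFrom (n + 1) i ≡ q (suc i)
  drop-first i = cong P (+-assoc n 1 i)

  shifted-above : 2 * Den (q ∘ suc) k′ < Num (q ∘ suc) k′
  shifted-above = subst₂ (λ D N → 2 * D < N)
    (prod-cong (cong minus1 ∘ drop-first) k′) (prod-cong drop-first k′) (above-two (n + 1) k′ above′)
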